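{- Let $W$ be a positive integer, let $\mathcal F=T_1,\dots,T_k$ be a rooted ordered forest with $m\le W$ vertices, and let $\Gamma$ be a $◸$-drawing of $\mathcal F$. Then for each $i=1,\dots,k$, the drawings of $T_1,\dots,T_i$ in $\Gamma$ lie inside or on the boundary of the triangle delimited by the $y$-axis, the half-line $\ell(r(T_i))$, and the horizontal line $y=2W+2$.
   Context: A rooted ordered forest is a sequence of rooted trees with a left-to-right order of the children of every vertex; $T(u)$ is the subtree rooted at $u$. A drawing is strictly-upward (resp. strictly-leftward) if each edge is a curve strictly increasing in $y$ (resp. strictly decreasing in $x$) from a vertex to its parent; order-preserving if the left-to-right order of edges to children matches the given order. For a point $v$, $\ell(v)$ is the closed half-line from $v$ with slope $-2$ going downward to the right, and $S(v)$ is the closed wedge with apex $v$ swept by rotating the rightward horizontal half-line from $v$ clockwise until it coincides with $\ell(v)$. A $◸$-drawing of $\mathcal F$ (w.r.t. $W$) is a planar straight-line strictly-upward strictly-leftward order-preserving drawing with vertices at integer points such that: (i) it lies in $[0,m-1]\times[4W-2m+2,4W]$; (ii) the roots $r(T_1),\dots,r(T_k)$ lie on the segment from $(0,2W+2)$ to $(0,4W)$ in this order bottom to top, with $r(T_k)$ at $(0,4W)$; (iii) vertices of $T_i$ have $y$-coordinates strictly smaller than those of $T_{i+1}$; (iv) for each vertex $v$ with children $u_1,\dots,u_\ell$ in left-to-right order, vertices of the subtree rooted at $u_j$ have $y$-coordinates strictly smaller than those of the subtree rooted at $u_{j+1}$; (v) for every vertex $v$, $S(v)$ meets the drawing only alo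ng $\ell(v)$.
   Formalization: Only the points of the drawing Γ with rational coordinates, its vertices and the points of its edges alike, are considered. -}

module Defs where

open import Data.Nat as ℕ using (ℕ; zero; suc)
open import Data.Integer as ℤ using (ℤ; +_)
open import Data.Rational as ℚ using (ℚ; 0ℚ; 1ℚ)
open import Data.Fin as Fin using (Fin; toℕ)
open import Data.List using (List; []; _∷_; length; lookup)
open import Data.Product using (Σ; ∃; ∃-syntax; _×_; _,_; proj₁; proj₂)
open import Data.Sum using (_⊎_)
open import Data.Unit using (⊤)
open import Relation.Nullary using (¬_)
open import Relation.Binary.PropositionalEquality using (_≡_; _≢_)

data Tree : Set where
  node : List Tree → Tree

kids : Tree → List Tree
kids (node ts) = ts

Forest : Set
Forest = List Tree

size  : Tree → ℕ
sizes : List Tree → ℕ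
size (node ts) = suc (sizes ts)
sizes [] = 0
sizes (t ∷ ts) = size t ℕ.+ sizes ts

-- Vertices of a tree, as paths from the root.
data Pos : Tree → Set where
  root : ∀ {t} → Pos t
  down : ∀ {t} (i : Fin (length (kids t))) → Pos (lookup (kids t) i) → Pos t

sub : ∀ {t} → Pos t → Tree
sub {t} root = t
sub (down i p) = sub p

nkids : ∀ {t} → Pos t → ℕ
nkids p = length (kids (sub p))

-- The j-th child (0-based, left to right) of vertex p.
child : ∀ {t} (p : Pos t) → Fin (nkids p) → Pos t
child root j = down j root
child (down i p) j = down i (child p j)

-- Desc p q : q is a vertex of the subtree T(p) rooted at p.
data Desc : ∀ {t} → Pos t → Pos t → Set where
  desc-root : ∀ {t} (q : Pos t) → Desc root q
  desc-down : ∀ {t} (i : Fin (length (kids t))) {p q : Pos (lookup (kids t) i)} →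
              Desc p q → Desc {t} (down i p) (down i q)

-- Edges of a tree: each edge joins a non-root vertex to its parent.
data Edge : Tree → Set where
  top    : ∀ {t} (i : Fin (length (kids t))) → Edge t
  deeper : ∀ {t} (i : Fin (length (kids t))) → Edge (lookup (kids t) i) → Edge t

upper : ∀ {t} → Edge t → Pos t
upper (top i) = root
upper (deeper i e) = down i (upper e)

lower : ∀ {t} → Edge t → Pos t
lower (top i) = down i root
lower (deeper i e) = down i (lower e)

FPos : Forest → Set
FPos F = Σ (Fin (length F)) λ i → Pos (lookup F i)

FEdge : Forest → Set
FEdge F = Σ (Fin (length F)) λ i → Edge (lookup F i)

fupper : ∀ {F} → FEdge F → FPos F
fupper (i , e) = i , upper e

flower : ∀ {F} → FEdge F → FPos F
flower (i , e) = i , lower e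

froot : ∀ {F} → Fin (length F) → FPos F
froot i = i , root

FDesc : ∀ {F} → FPos F → FPos F → Set
FDesc {F} (i , p) (j , q) = Σ (i ≡ j) λ { _≡_.refl → Desc p q }

fchild : ∀ {F} (v : FPos F) → Fin (nkids (proj₂ v)) → FPos F
fchild (i , p) j = i , child p j

-- integer points (vertex positions) and real points; all points of a
-- straight-line drawing with integer vertices that matter are rational
--, so ℚ × ℚ is used for points on edges.
IPt : Set
IPt = ℤ × ℤ

QPt : Set
QPt = ℚ × ℚ

xI yI : IPt → ℤ
xI = proj₁
yI = proj₂

emb : IPt → QPt
emb (x , y) = (x ℚ./ 1) , (y ℚ./ 1)

segPt : QPt → QPt → ℚ → QPt
segPt (px , py) (qx , qy) t = (px ℚ.+ t ℚ.* (qx ℚ.- px)) , (py ℚ.+ t ℚ.* (qy ℚ.- py))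

OnSeg : IPt → IPt → QPt → Set
OnSeg p q z = Σ ℚ λ t → (0ℚ ℚ.≤ t) × (t ℚ.≤ 1ℚ) × (z ≡ segPt (emb p) (emb q) t)

two : ℚ
two = (+ 2) ℚ./ 1

-- ℓ(v): closed half-line from v of slope -2 going down to the right
Onℓ : IPt → QPt → Set
Onℓ v (x , y) = let (vx , vy) = emb v in
  (vx ℚ.≤ x) × (y ℚ.- vy ≡ ℚ.- (two ℚ.* (x ℚ.- vx)))

-- S(v): closed wedge between the rightward horizontal half-line from v
-- and ℓ(v) (swept clockwise)
InS : IPt → QPt → Set
InS v (x , y) = let (vx , vy) = emb v in
  (y ℚ.≤ vy) × (0ℚ ℚ.≤ (y ℚ.- vy) ℚ.+ two ℚ.* (x ℚ.- vx))

InTriangle : IPt → ℚ → QPt → Set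
InTriangle r c (x , y) = let (rx , ry) = emb r in
  (0ℚ ℚ.≤ x) × (c ℚ.≤ y) × ((y ℚ.- ry) ℚ.+ two ℚ.* (x ℚ.- rx) ℚ.≤ 0ℚ)

Drawing : Forest → Set
Drawing F = FPos F → IPt

module _ {F : Forest} (Γ : Drawing F) where

  OnEdge : FEdge F → QPt → Set
  OnEdge e z = OnSeg (Γ (fupper {F} e)) (Γ (flower {F} e)) z

  OnDrawingOf : (Fin (length F) → Set) → QPt → Set
  OnDrawingOf P z =
      (Σ (FPos F) λ v → P (proj₁ v) × (z ≡ emb (Γ v)))
    ⊎ (Σ (FEdge F) λ e → P (proj₁ e) × OnEdge e z)

  OnDrawing : QPt → Set
  OnDrawing = OnDrawingOf (λ _ → ⊤)

  IsEndpoint : FPos F → FEdge F → Set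
  IsEndpoint v e = (v ≡ fupper {F} e) ⊎ (v ≡ flower {F} e)

  Planar : Set
  Planar =
      (∀ u v → Γ u ≡ Γ v → u ≡ v)
    × (∀ v e → ¬ IsEndpoint v e → ¬ OnEdge e (emb (Γ v)))
    × (∀ e f → e ≢ f → ∀ z → OnEdge e z → OnEdge f z →
         Σ (FPos F) λ v → IsEndpoint v e × IsEndpoint v f × (z ≡ emb (Γ v)))

  StrictlyUpward : Set
  StrictlyUpward = ∀ e → yI (Γ (flower {F} e)) ℤ.< yI (Γ (fupper {F} e))

  StrictlyLeftward : Set
  StrictlyLeftward = ∀ e → xI (Γ (fupper {F} e)) ℤ.< xI (Γ (flower {F} e))

  -- the edges to consecutive children u_j, u_{j+1} of v appear in
  -- left-to-right order around v: (u_{j+1} - v) is counterclockwise from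
  -- (u_j - v) (cross product positive)
  OrderPreserving : Set
  OrderPreserving = ∀ (v : FPos F) (j j' : Fin (nkids (proj₂ v))) →
    toℕ j' ≡ suc (toℕ j) →
    let (vx , vy) = Γ v
        (ax , ay) = Γ (fchild {F} v j)
        (bx , by) = Γ (fchild {F} v j')
    in ℤ.0ℤ ℤ.< ((ax ℤ.- vx) ℤ.* (by ℤ.- vy)) ℤ.- ((ay ℤ.- vy) ℤ.* (bx ℤ.- vx))

  IsUpperLeftDrawing : ℕ → Set
  IsUpperLeftDrawing W =
      Planar × StrictlyUpward × StrictlyLeftward × OrderPreserving
      -- (i)
    × (∀ z → OnDrawing z →
         let (x , y) = z in
         (0ℚ ℚ.≤ x) × (x ℚ.≤ (+ m ℤ.- + 1) ℚ./ 1)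
       × (((+ (4 ℕ.* W)) ℤ.- (+ (2 ℕ.* m)) ℤ.+ + 2) ℚ./ 1 ℚ.≤ y)
       × (y ℚ.≤ (+ (4 ℕ.* W)) ℚ./ 1))
    × (∀ i → (xI (Γ (froot {F} i)) ≡ + 0)
           × (+ (2 ℕ.* W ℕ.+ 2) ℤ.≤ yI (Γ (froot {F} i)))
           × (yI (Γ (froot {F} i)) ℤ.≤ + (4 ℕ.* W)))
    × (∀ i i' → i Fin.< i' → yI (Γ (froot {F} i)) ℤ.< yI (Γ (froot {F} i')))
    × (∀ i → toℕ i ≡ length F ℕ.∸ 1 → Γ (froot {F} i) ≡ (+ 0 , + (4 ℕ.* W)))
      -- (iii)
    × (∀ (u v : FPos F) → proj₁ u Fin.< proj₁ v → yI (Γ u) ℤ.< yI (Γ v))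
    × (∀ (v : FPos F) (j j' : Fin (nkids (proj₂ v))) → toℕ j' ≡ suc (toℕ j) →
         ∀ a b → FDesc {F} (fchild {F} v j) a → FDesc {F} (fchild {F} v j') b →
         yI (Γ a) ℤ.< yI (Γ b))
      -- (v)
    × (∀ v z → OnDrawing z → InS (Γ v) z → Onℓ (Γ v) z)
    where m = sizes F

-- Every point of the drawings of T₁, …, Tᵢ is at height at most y(r(Tᵢ)): inside Tᵢ because
-- edges go strictly upward towards the root, and below Tᵢ by (iii). A point at that height
-- or lower lies in the wedge S(r(Tᵢ)) exactly when it is on or right of ℓ(r(Tᵢ)), so by (v)
-- it is on or left of ℓ(r(Tᵢ)). The other two sides of the triangle come from (i) and m ≤ W.
module Submission where

open import Defs
open import Data.Nat using (ℕ; _≤_; _<_; _+_; _*_)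
open import Data.Integer using (+_)
open import Data.Rational using (_/_)
open import Data.Fin using (Fin) renaming (_≤_ to _≤ᶠ_)
open import Data.List using (length; lookup)

import Data.Nat as ℕ
import Data.Nat.Properties as ℕ
import Data.Integer as ℤ
import Data.Integer.Properties as ℤ
import Data.Rational as ℚ
import Data.Rational.Properties as ℚ
import Data.Rational.Unnormalised as ℚᵘ
import Data.Rational.Unnormalised.Properties as ℚᵘ
import Data.Fin as Fin
import Data.Fin.Properties as Fin
open import Data.Product using (_,_; proj₁; proj₂)
open import Data.Sum using (inj₁; inj₂)
open import Data.Unit using (tt)
open import Relation.Nullary using (yes; no)
open import Relation.Binary.PropositionalEquality
  using (refl; sym; cong; subst₂; module ≡-Reasoning)

/1-mono-≤ : ∀ {i j : ℤ.ℤ} → i ℤ.≤ j → i / 1 ℚ.≤ j / 1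
/1-mono-≤ {i} {j} i≤j = ℚ.toℚᵘ-cancel-≤
  (ℚᵘ.≤-respˡ-≃ (ℚᵘ.≃-sym (ℚ.toℚᵘ-fromℚᵘ (ℚᵘ.mkℚᵘ i 0)))
    (ℚᵘ.≤-respʳ-≃ (ℚᵘ.≃-sym (ℚ.toℚᵘ-fromℚᵘ (ℚᵘ.mkℚᵘ j 0)))
      (ℚᵘ.*≤* (subst₂ ℤ._≤_ (sym (ℤ.*-identityʳ i)) (sym (ℤ.*-identityʳ j)) i≤j))))

root-highest : ∀ t (g : Pos t → IPt) →
  (∀ e → yI (g (lower e)) ℤ.< yI (g (upper e))) →
  ∀ p → yI (g p) ℤ.≤ yI (g root)
root-highest t g up root = ℤ.≤-refl
root-highest (node ts) g up (down k p) = ℤ.≤-trans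
  (root-highest (lookup ts k) (λ q → g (down k q)) (λ e → up (deeper k e)) p)
  (ℤ.<⇒≤ (up (top k)))

segment-≤-start : ∀ a b t → ℚ.0ℚ ℚ.≤ t → b ℚ.≤ a → a ℚ.+ t ℚ.* (b ℚ.- a) ℚ.≤ a
segment-≤-start a b t 0≤t b≤a = begin
  a ℚ.+ t ℚ.* (b ℚ.- a) ≤⟨ ℚ.+-monoʳ-≤ a t*[b-a]≤0 ⟩
  a ℚ.+ ℚ.0ℚ            ≡⟨ ℚ.+-identityʳ a ⟩
  a                     ∎
  where
  open ℚ.≤-Reasoning
  instance
    t-nonNeg : ℚ.NonNegative t
    t-nonNeg = ℚ.nonNegative 0≤t
  b-a≤0 : b ℚ.- a ℚ.≤ ℚ.0ℚ
  b-a≤0 = ℚ.≤-trans (ℚ.+-monoˡ-≤ (ℚ.- a) b≤a) (ℚ.≤-reflexive (ℚ.+-inverseʳ a))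
  t*[b-a]≤0 : t ℚ.* (b ℚ.- a) ℚ.≤ ℚ.0ℚ
  t*[b-a]≤0 = ℚ.≤-trans (ℚ.*-monoˡ-≤-nonNeg t b-a≤0) (ℚ.≤-reflexive (ℚ.*-zeroʳ t))

onℓ-or-left-of-ℓ : ∀ v z → proj₂ z ℚ.≤ proj₂ (emb v) → (InS v z → Onℓ v z) →
  let (vx , vy) = emb v in (proj₂ z ℚ.- vy) ℚ.+ two ℚ.* (proj₁ z ℚ.- vx) ℚ.≤ ℚ.0ℚ
onℓ-or-left-of-ℓ v (x , y) y≤vy wedge⇒ℓ
  with ℚ.≤-total ℚ.0ℚ ((y ℚ.- proj₂ (emb v)) ℚ.+ two ℚ.* (x ℚ.- proj₁ (emb v)))
... | inj₂ left-of-ℓ = left-of-ℓ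
... | inj₁ in-wedge = ℚ.≤-reflexive (begin
  (y ℚ.- proj₂ (emb v)) ℚ.+ d ≡⟨ cong (ℚ._+ d) (proj₂ (wedge⇒ℓ (y≤vy , in-wedge))) ⟩
  ℚ.- d ℚ.+ d                 ≡⟨ ℚ.+-inverseˡ d ⟩
  ℚ.0ℚ                        ∎)
  where
  open ≡-Reasoning
  d : ℚ.ℚ
  d = two ℚ.* (x ℚ.- proj₁ (emb v))

m≤n⇒2n≤4n∸2m : ∀ {m n} → m ≤ n → 2 * n ≤ 4 * n ℕ.∸ 2 * m
m≤n⇒2n≤4n∸2m {m} {n} m≤n = begin
  2 * n                   ≡⟨ ℕ.m+n∸n≡m (2 * n) (2 * n) ⟨
  2 * n + 2 * n ℕ.∸ 2 * n ≡⟨ cong (ℕ._∸ 2 * n) (ℕ.*-distribʳ-+ n 2 2) ⟨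
  4 * n ℕ.∸ 2 * n         ≤⟨ ℕ.∸-monoʳ-≤ (4 * n) (ℕ.*-monoʳ-≤ 2 m≤n) ⟩
  4 * n ℕ.∸ 2 * m         ∎
  where open ℕ.≤-Reasoning

2W+2≤4W-2m+2 : ∀ W m → m ≤ W → + (2 * W + 2) ℤ.≤ + (4 * W) ℤ.- + (2 * m) ℤ.+ + 2
2W+2≤4W-2m+2 W m m≤W = ℤ.+-monoˡ-≤ (+ 2) (begin
  + (2 * W)               ≤⟨ ℤ.+≤+ (m≤n⇒2n≤4n∸2m m≤W) ⟩
  + (4 * W ℕ.∸ 2 * m)     ≡⟨ ℤ.⊖-≥ 2m≤4W ⟨
  (4 * W) ℤ.⊖ (2 * m)     ≡⟨ ℤ.m-n≡m⊖n (4 * W) (2 * m) ⟨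
  + (4 * W) ℤ.- + (2 * m) ∎)
  where
  open ℤ.≤-Reasoning
  2m≤4W : 2 * m ≤ 4 * W
  2m≤4W = ℕ.≤-trans (ℕ.*-monoʳ-≤ 2 m≤W) (ℕ.*-monoˡ-≤ W {2} {4} (ℕ.s≤s (ℕ.s≤s ℕ.z≤n)))

onDrawingOf⇒onDrawing : ∀ {F} (Γ : Drawing F) {P z} → OnDrawingOf {F} Γ P z → OnDrawing {F} Γ z
onDrawingOf⇒onDrawing Γ (inj₁ (v , _ , z≡v)) = inj₁ (v , tt , z≡v)
onDrawingOf⇒onDrawing Γ (inj₂ (e , _ , z∈e)) = inj₂ (e , tt , z∈e)

module _ {F : Forest} (Γ : Drawing F) (up : StrictlyUpward {F} Γ)
         (earlier-lower : ∀ (u v : FPos F) → proj₁ u Fin.< proj₁ v → yI (Γ u) ℤ.< yI (Γ v))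
         (i : Fin (length F)) where

  vertex-below-root : ∀ (v : FPos F) → proj₁ v ≤ᶠ i → yI (Γ v) ℤ.≤ yI (Γ (froot {F} i))
  vertex-below-root (j , p) j≤i with j Fin.≟ i
  ... | yes refl = root-highest (lookup F i) (λ q → Γ (i , q)) (λ e → up (i , e)) p
  ... | no j≢i = ℤ.<⇒≤ (earlier-lower (j , p) (froot {F} i) (Fin.≤∧≢⇒< j≤i j≢i))

  point-below-root : ∀ z → OnDrawingOf {F} Γ (_≤ᶠ i) z → proj₂ z ℚ.≤ yI (Γ (froot {F} i)) / 1
  point-below-root _ (inj₁ (v , v≤i , refl)) = /1-mono-≤ (vertex-below-root v v≤i)
  point-below-root _ (inj₂ (e , e≤i , (t , 0≤t , _ , refl))) = ℚ.≤-trans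
    (segment-≤-start _ _ t 0≤t (/1-mono-≤ (ℤ.<⇒≤ (up e))))
    (/1-mono-≤ (vertex-below-root (fupper {F} e) e≤i))

mainTheorem5 : (W : ℕ) → 0 < W → (F : Forest) → sizes F ≤ W →
    (Γ : Drawing F) → IsUpperLeftDrawing {F} Γ W →
    (i : Fin (length F)) → (z : QPt) →
    OnDrawingOf {F} Γ (λ j → j ≤ᶠ i) z →
    InTriangle (Γ (froot {F} i)) ((+ (2 * W + 2)) / 1) z
mainTheorem5 W _ F m≤W Γ (_ , up , _ , _ , inBox , _ , _ , _ , earlier-lower , _ , wedge) i z z∈Γ≤i =
    x≥0
  , ℚ.≤-trans (/1-mono-≤ (2W+2≤4W-2m+2 W (sizes F) m≤W)) y≥4W-2m+2
  , onℓ-or-left-of-ℓ (Γ (froot {F} i)) z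
      (point-below-root {F} Γ up earlier-lower i z z∈Γ≤i) (wedge (froot {F} i) z z∈Γ)
  where
  z∈Γ : OnDrawing {F} Γ z
  z∈Γ = onDrawingOf⇒onDrawing {F} Γ z∈Γ≤i
  x≥0 : ℚ.0ℚ ℚ.≤ proj₁ z
  x≥0 = proj₁ (inBox z z∈Γ)
  y≥4W-2m+2 : (+ (4 * W) ℤ.- + (2 * sizes F) ℤ.+ + 2) / 1 ℚ.≤ proj₂ z
  y≥4W-2m+2 = proj₁ (proj₂ (proj₂ (inBox z z∈Γ)))
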